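{- Let $F$ be a field and $n\ge4$. Let $T_{1,n}=\left\{\begin{pmatrix}1&x\\0&A\end{pmatrix}: A\in\mathrm{GL}_n(F),\ x\in M_{1\times n}(F)\right\}\leqslant\mathrm{GL}_{n+1}(F)$ and let $\pi:T_{1,n}\to\mathrm{GL}_n(F)$ be the projection to the lower right $n\times n$ block. Let $\Gamma\leqslant T_{1,n}$ be a subgroup such that (a) $\pi$ is injective on $\Gamma$, and (b) $\pi(\Gamma)\supseteq\mathrm{SL}_n(F)$. Then there exists $U\in T_{1,n}$ such that $$U^{ -1}\Gamma U\subseteq\left\{\begin{pmatrix}1&0\\0&A\end{pmatrix}: A\in\mathrm{GL}_n(F)\right\}.$$ -}

module Defs where

open import Level using (Level; _⊔_)
open import Data.Nat using (ℕ; zero; suc)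
open import Data.Fin using (Fin; zero; suc; punchIn; toℕ)
open import Data.Product using (Σ; ∃; _×_; _,_)
open import Relation.Nullary using (¬_)
open import Algebra.Bundles using (CommutativeRing)

record Field (c ℓ : Level) : Set (Level.suc (c ⊔ ℓ)) where
  field
    commutativeRing : CommutativeRing c ℓ
  open CommutativeRing commutativeRing public
  field
    1≉0 : ¬ (1# ≈ 0#)
    inverse : ∀ x → ¬ (x ≈ 0#) → Σ Carrier (λ y → (x * y) ≈ 1#)

module FieldMatrices {c ℓ : Level} (F : Field c ℓ) where
  open Field F using (Carrier; _≈_; _+_; _*_; -_; 0#; 1#)

  Mat : ℕ → ℕ → Set c
  Mat m n = Fin m → Fin n → Carrier

  _≋_ : ∀ {m n} → Mat m n → Mat m n → Set ℓ
  A ≋ B = ∀ i j → A i j ≈ B i j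

  Σ[_] : ∀ n → (Fin n → Carrier) → Carrier
  Σ[ zero ] f = 0#
  Σ[ suc n ] f = f zero + Σ[ n ] (λ i → f (suc i))

  _·_ : ∀ {m n p} → Mat m n → Mat n p → Mat m p
  _·_ {n = n} A B i k = Σ[ n ] (λ j → A i j * B j k)

  I : ∀ {n} → Mat n n
  I {suc n} zero zero = 1#
  I {suc n} zero (suc j) = 0#
  I {suc n} (suc i) zero = 0#
  I {suc n} (suc i) (suc j) = I i j

  sign : ℕ → Carrier
  sign zero = 1#
  sign (suc k) = - sign k

  det : ∀ {n} → Mat n n → Carrier
  det {zero} A = 1#
  det {suc n} A =
    Σ[ suc n ] (λ j → (sign (toℕ j) * A zero j) * det (λ i k → A (suc i) (punchIn j k)))

  IsGL : ∀ {n} → Mat n n → Set (c ⊔ ℓ)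
  IsGL {n} A = Σ (Mat n n) (λ B → ((A · B) ≋ I) × ((B · A) ≋ I))

  IsSL : ∀ {n} → Mat n n → Set ℓ
  IsSL A = det A ≈ 1#

  block : ∀ {n} → Mat 1 n → Mat n n → Mat (suc n) (suc n)
  block x A zero zero = 1#
  block x A zero (suc j) = x zero j
  block x A (suc i) zero = 0#
  block x A (suc i) (suc j) = A i j

  InT : ∀ {n} → Mat (suc n) (suc n) → Set (c ⊔ ℓ)
  InT {n} M = Σ (Mat 1 n) (λ x → Σ (Mat n n) (λ A → IsGL A × (M ≋ block x A)))

  InD : ∀ {n} → Mat (suc n) (suc n) → Set (c ⊔ ℓ)
  InD {n} M = Σ (Mat n n) (λ A → IsGL A × (M ≋ block (λ _ _ → 0#) A))

  π : ∀ {n} → Mat (suc n) (suc n) → Mat n n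
  π M i j = M (suc i) (suc j)

  record IsSubgroup {p : Level} {m : ℕ} (Γ : Mat m m → Set p) : Set (c ⊔ ℓ ⊔ p) where
    field
      resp : ∀ {g h} → g ≋ h → Γ g → Γ h
      has-I : Γ I
      closed-· : ∀ {g h} → Γ g → Γ h → Γ (g · h)
      has-inv : ∀ {g} → Γ g → Σ (Mat m m) (λ h → Γ h × ((g · h) ≋ I) × ((h · g) ≋ I))

{-# OPTIONS --safe #-}
module Submission where

-- Write g ∈ Γ as (1 c(g) ; 0 π(g)). Then c(gh) = c(h) + c(g)·π(h), and conjugating by the shear
-- (1 u ; 0 I) replaces c(g) by the defect c(g) + u − u·π(g), which satisfies the same cocycle rule.
-- Since π is injective on Γ, c(g) only depends on π(g), so relations in SLₙ constrain c: an
-- elementary matrix E i j t commuting with some E m l 1 forces c to vanish off coordinate j, and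
-- the commutator relation [E i k 1, E k j t] = E i j t makes c(E i j t) = t·uᵢ·eⱼ for one vector u
-- (n ≥ 4 leaves room for the auxiliary indices). Hence the defect of u vanishes on lifts of elementary
-- matrices, so on lifts of all transvections, which are products of them. Finally π(g) conjugates
-- E i j 1 into a transvection, and comparing defects in g·gᴱ = gτ·g shows that the defect of g is 0.

open import Defs
open import Level using (Level; _⊔_)
open import Data.Nat using (ℕ; zero; suc; _≤_; _<_)
open import Data.Nat.Properties using (<⇒≤)
open import Data.Fin using (Fin; zero; suc; punchIn; toℕ; _≟_)
open import Data.Fin.Properties using (pigeonhole; ¬∀⟶∃¬; any?; <⇒≢; punchInᵢ≢i)
open import Data.Product using (Σ; ∃; _×_; _,_; proj₁; proj₂)
open import Data.Empty using (⊥-elim)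
open import Data.Unit using (⊤; tt)
open import Data.Vec.Functional using (Vector; updateAt; _∷_; [])
open import Data.Vec.Functional.Properties using (updateAt-updates; updateAt-minimal)
open import Function using (_∘_)
open import Relation.Nullary using (¬_; yes; no)
open import Relation.Unary using (Decidable)
open import Relation.Binary.PropositionalEquality as ≡ using (_≡_; _≢_)
open import Relation.Binary.Bundles using (Setoid)
import Relation.Binary.Reasoning.Setoid

fresh : ∀ {k n} → k < n → (xs : Fin k → Fin n) → ∃ λ l → ∀ i → l ≢ xs i
fresh {k} {n} k<n xs =
  let l , l∉ = ¬∀⟶∃¬ n Hit hit? not-all in l , λ i l≡xsi → l∉ (i , l≡xsi)
  where
  Hit : Fin n → Set
  Hit l = ∃ λ i → l ≡ xs i

  hit? : Decidable Hit
  hit? l = any? (λ i → l ≟ xs i)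

  not-all : ¬ (∀ l → Hit l)
  not-all hit =
    let i , j , i<j , same = pigeonhole k<n (proj₁ ∘ hit) in
    <⇒≢ i<j (≡.trans (proj₂ (hit i)) (≡.trans (≡.cong xs same) (≡.sym (proj₂ (hit j)))))

module Linear {c ℓ : Level} (F : Field c ℓ) where
  open Field F hiding (zero)
  open FieldMatrices F
  open import Algebra.Properties.Semiring.Sum semiring
    using (sum; sum-cong-≋; sum-replicate-zero; ∑-distrib-+; ∑-comm; *-distribˡ-sum; *-distribʳ-sum)
  open import Algebra.Properties.Ring ring using (-1*x≈-x; -‿distribˡ-*; x[y-z]≈xy-xz)
  open import Algebra.Properties.Group +-group using (ε⁻¹≈ε)
  open import Data.Vec.Functional.Relation.Binary.Equality.Setoid setoid public
    using () renaming (_≋_ to _≐_; ≋-refl to ≐-refl)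
  open import Algebra.Solver.Ring.NaturalCoefficients.Default commutativeSemiring
    using (solve; _:=_; _:+_; _:*_)
  module ≈-Reasoning = Relation.Binary.Reasoning.Setoid setoid

  *-zeroˡ-≈ : ∀ {x y} → x ≈ 0# → x * y ≈ 0#
  *-zeroˡ-≈ x≈0 = trans (*-congʳ x≈0) (zeroˡ _)

  *-zeroʳ-≈ : ∀ {x y} → y ≈ 0# → x * y ≈ 0#
  *-zeroʳ-≈ y≈0 = trans (*-congˡ y≈0) (zeroʳ _)

  +-identityˡ-≈ : ∀ {x y} → x ≈ 0# → x + y ≈ y
  +-identityˡ-≈ x≈0 = trans (+-congʳ x≈0) (+-identityˡ _)

  +-identityʳ-≈ : ∀ {x y} → y ≈ 0# → x + y ≈ x
  +-identityʳ-≈ y≈0 = trans (+-congˡ y≈0) (+-identityʳ _)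

  Σ≡sum : ∀ n (f : Fin n → Carrier) → Σ[ n ] f ≡ sum f
  Σ≡sum zero f = ≡.refl
  Σ≡sum (suc n) f = ≡.cong (f zero +_) (Σ≡sum n (f ∘ suc))

  Σ-cong : ∀ n {f g : Fin n → Carrier} → (∀ i → f i ≈ g i) → Σ[ n ] f ≈ Σ[ n ] g
  Σ-cong n {f} {g} f≈g = begin
    Σ[ n ] f ≡⟨ Σ≡sum n f ⟩
    sum f    ≈⟨ sum-cong-≋ f≈g ⟩
    sum g    ≡⟨ Σ≡sum n g ⟨
    Σ[ n ] g ∎
    where open ≈-Reasoning

  Σ-zero : ∀ n {f : Fin n → Carrier} → (∀ i → f i ≈ 0#) → Σ[ n ] f ≈ 0#
  Σ-zero n {f} f≈0 = begin
    Σ[ n ] f               ≈⟨ Σ-cong n f≈0 ⟩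
    Σ[ n ] (λ _ → 0#)      ≡⟨ Σ≡sum n _ ⟩
    sum {n} (λ _ → 0#)     ≈⟨ sum-replicate-zero n ⟩
    0#                     ∎
    where open ≈-Reasoning

  Σ-distrib-+ : ∀ n (f g : Fin n → Carrier) → Σ[ n ] (λ i → f i + g i) ≈ Σ[ n ] f + Σ[ n ] g
  Σ-distrib-+ n f g = begin
    Σ[ n ] (λ i → f i + g i) ≡⟨ Σ≡sum n _ ⟩
    sum (λ i → f i + g i)    ≈⟨ ∑-distrib-+ f g ⟩
    sum f + sum g            ≡⟨ ≡.cong₂ _+_ (Σ≡sum n f) (Σ≡sum n g) ⟨
    Σ[ n ] f + Σ[ n ] g      ∎
    where open ≈-Reasoning

  Σ-comm : ∀ m n (f : Fin m → Fin n → Carrier) →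
    Σ[ m ] (λ i → Σ[ n ] (f i)) ≈ Σ[ n ] (λ j → Σ[ m ] (λ i → f i j))
  Σ-comm m n f = begin
    Σ[ m ] (λ i → Σ[ n ] (f i))           ≈⟨ Σ-cong m (λ i → reflexive (Σ≡sum n (f i))) ⟩
    Σ[ m ] (λ i → sum (f i))              ≡⟨ Σ≡sum m _ ⟩
    sum (λ i → sum (f i))                 ≈⟨ ∑-comm f ⟩
    sum (λ j → sum (λ i → f i j))         ≡⟨ Σ≡sum n _ ⟨
    Σ[ n ] (λ j → sum (λ i → f i j))      ≈⟨ Σ-cong n (λ j → reflexive (Σ≡sum m _)) ⟨
    Σ[ n ] (λ j → Σ[ m ] (λ i → f i j))   ∎
    where open ≈-Reasoning

  *-distribˡ-Σ : ∀ n x (f : Fin n → Carrier) → x * Σ[ n ] f ≈ Σ[ n ] (λ i → x * f i)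
  *-distribˡ-Σ n x f = begin
    x * Σ[ n ] f             ≡⟨ ≡.cong (x *_) (Σ≡sum n f) ⟩
    x * sum f                ≈⟨ *-distribˡ-sum x f ⟩
    sum (λ i → x * f i)      ≡⟨ Σ≡sum n _ ⟨
    Σ[ n ] (λ i → x * f i)   ∎
    where open ≈-Reasoning

  *-distribʳ-Σ : ∀ n x (f : Fin n → Carrier) → Σ[ n ] f * x ≈ Σ[ n ] (λ i → f i * x)
  *-distribʳ-Σ n x f = begin
    Σ[ n ] f * x             ≡⟨ ≡.cong (_* x) (Σ≡sum n f) ⟩
    sum f * x                ≈⟨ *-distribʳ-sum x f ⟩
    sum (λ i → f i * x)      ≡⟨ Σ≡sum n _ ⟨
    Σ[ n ] (λ i → f i * x)   ∎
    where open ≈-Reasoning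

  Σ-neg : ∀ n (f : Fin n → Carrier) → Σ[ n ] (λ i → - f i) ≈ - Σ[ n ] f
  Σ-neg n f = begin
    Σ[ n ] (λ i → - f i)       ≈⟨ Σ-cong n (λ i → -1*x≈-x (f i)) ⟨
    Σ[ n ] (λ i → - 1# * f i)  ≈⟨ *-distribˡ-Σ n (- 1#) f ⟨
    - 1# * Σ[ n ] f            ≈⟨ -1*x≈-x _ ⟩
    - Σ[ n ] f                 ∎
    where open ≈-Reasoning

  Σ-distrib-minus : ∀ n (f g : Fin n → Carrier) → Σ[ n ] (λ i → f i - g i) ≈ Σ[ n ] f - Σ[ n ] g
  Σ-distrib-minus n f g = trans (Σ-distrib-+ n f (λ i → - g i)) (+-congˡ (Σ-neg n g))

  I-sym : ∀ {n} (i j : Fin n) → I i j ≡ I j i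
  I-sym zero zero = ≡.refl
  I-sym zero (suc j) = ≡.refl
  I-sym (suc i) zero = ≡.refl
  I-sym (suc i) (suc j) = I-sym i j

  I-diag : ∀ {n} (i : Fin n) → I i i ≡ 1#
  I-diag zero = ≡.refl
  I-diag (suc i) = I-diag i

  I-off : ∀ {n} {i j : Fin n} → i ≢ j → I i j ≡ 0#
  I-off {i = zero} {zero} i≢j = ⊥-elim (i≢j ≡.refl)
  I-off {i = zero} {suc j} i≢j = ≡.refl
  I-off {i = suc i} {zero} i≢j = ≡.refl
  I-off {i = suc i} {suc j} i≢j = I-off (i≢j ∘ ≡.cong suc)

  Σ-selectˡ : ∀ n (k : Fin n) (f : Fin n → Carrier) → Σ[ n ] (λ m → I k m * f m) ≈ f k
  Σ-selectˡ (suc n) zero f = begin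
    1# * f zero + Σ[ n ] (λ m → 0# * f (suc m)) ≈⟨ +-cong (*-identityˡ _) (Σ-zero n (λ m → zeroˡ _)) ⟩
    f zero + 0#                                  ≈⟨ +-identityʳ _ ⟩
    f zero                                       ∎
    where open ≈-Reasoning
  Σ-selectˡ (suc n) (suc k) f = begin
    0# * f zero + Σ[ n ] (λ m → I k m * f (suc m)) ≈⟨ +-cong (zeroˡ _) (Σ-selectˡ n k (f ∘ suc)) ⟩
    0# + f (suc k)                                  ≈⟨ +-identityˡ _ ⟩
    f (suc k)                                       ∎
    where open ≈-Reasoning

  Σ-selectʳ : ∀ n (k : Fin n) (f : Fin n → Carrier) → Σ[ n ] (λ m → f m * I m k) ≈ f k
  Σ-selectʳ n k f = begin
    Σ[ n ] (λ m → f m * I m k)  ≈⟨ Σ-cong n (λ m → trans (*-comm _ _) (*-congʳ (reflexive (I-sym m k)))) ⟩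
    Σ[ n ] (λ m → I k m * f m)  ≈⟨ Σ-selectˡ n k f ⟩
    f k                         ∎
    where open ≈-Reasoning

  ≋-refl : ∀ {m n} {A : Mat m n} → A ≋ A
  ≋-refl i j = refl

  ≋-sym : ∀ {m n} {A B : Mat m n} → A ≋ B → B ≋ A
  ≋-sym A≋B i j = sym (A≋B i j)

  ≋-trans : ∀ {m n} {A B C : Mat m n} → A ≋ B → B ≋ C → A ≋ C
  ≋-trans A≋B B≋C i j = trans (A≋B i j) (B≋C i j)

  Mat-setoid : ℕ → ℕ → Setoid c ℓ
  Mat-setoid m n = record
    { Carrier = Mat m n ; _≈_ = _≋_
    ; isEquivalence = record { refl = ≋-refl ; sym = ≋-sym ; trans = ≋-trans } }

  module ≋-Reasoning {m n : ℕ} = Relation.Binary.Reasoning.Setoid (Mat-setoid m n)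

  ·-cong : ∀ {m n p} {A A' : Mat m n} {B B' : Mat n p} → A ≋ A' → B ≋ B' → (A · B) ≋ (A' · B')
  ·-cong {n = n} A≋A' B≋B' i k = Σ-cong n (λ j → *-cong (A≋A' i j) (B≋B' j k))

  ·-assoc : ∀ {m n p q} (A : Mat m n) (B : Mat n p) (C : Mat p q) → ((A · B) · C) ≋ (A · (B · C))
  ·-assoc {n = n} {p = p} A B C i l = begin
    Σ[ p ] (λ k → Σ[ n ] (λ j → A i j * B j k) * C k l)   ≈⟨ Σ-cong p (λ k → *-distribʳ-Σ n (C k l) _) ⟩
    Σ[ p ] (λ k → Σ[ n ] (λ j → A i j * B j k * C k l))   ≈⟨ Σ-comm p n _ ⟩
    Σ[ n ] (λ j → Σ[ p ] (λ k → A i j * B j k * C k l))   ≈⟨ Σ-cong n (λ j → Σ-cong p (λ k → *-assoc _ _ _)) ⟩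
    Σ[ n ] (λ j → Σ[ p ] (λ k → A i j * (B j k * C k l))) ≈⟨ Σ-cong n (λ j → *-distribˡ-Σ p (A i j) _) ⟨
    Σ[ n ] (λ j → A i j * Σ[ p ] (λ k → B j k * C k l))   ∎
    where open ≈-Reasoning

  ·-identityˡ : ∀ {m n} (A : Mat m n) → (I · A) ≋ A
  ·-identityˡ {m} A i k = Σ-selectˡ m i (λ j → A j k)

  ·-identityʳ : ∀ {m n} (A : Mat m n) → (A · I) ≋ A
  ·-identityʳ {n = n} A i k = Σ-selectʳ n k (A i)

  V : ℕ → Set c
  V = Vector Carrier

  infixl 7 _*ᵛ_
  infixl 6 _+ᵛ_

  _+ᵛ_ : ∀ {n} → V n → V n → V n
  (x +ᵛ y) i = x i + y i

  _*ᵛ_ : ∀ {n} → Carrier → V n → V n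
  (t *ᵛ x) i = t * x i

  -ᵛ_ : ∀ {n} → V n → V n
  (-ᵛ x) i = - x i

  row : ∀ {n} → V n → Mat 1 n
  row x _ = x

  dot : ∀ {n} → V n → V n → Carrier
  dot {n} x y = Σ[ n ] (λ j → x j * y j)

  _⊙_ : ∀ {m n} → V m → Mat m n → V n
  _⊙_ {m} x A k = Σ[ m ] (λ j → x j * A j k)

  _⊛_ : ∀ {m n} → Mat m n → V n → V m
  _⊛_ {n = n} A y i = Σ[ n ] (λ j → A i j * y j)

  dot-cong : ∀ {n} {x x' y y' : V n} → x ≐ x' → y ≐ y' → dot x y ≈ dot x' y'
  dot-cong {n} x≐x' y≐y' = Σ-cong n (λ j → *-cong (x≐x' j) (y≐y' j))

  dot-comm : ∀ {n} (x y : V n) → dot x y ≈ dot y x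
  dot-comm {n} x y = Σ-cong n (λ j → *-comm (x j) (y j))

  dot-selectˡ : ∀ {n} (k : Fin n) (x : V n) → dot (I k) x ≈ x k
  dot-selectˡ {n} = Σ-selectˡ n

  dot-selectʳ : ∀ {n} (x : V n) (k : Fin n) → dot x (I k) ≈ x k
  dot-selectʳ x k = trans (dot-comm x (I k)) (dot-selectˡ k x)

  dot-*ᵛʳ : ∀ {n} (x y : V n) t → dot x (t *ᵛ y) ≈ t * dot x y
  dot-*ᵛʳ {n} x y t = trans (Σ-cong n (λ j → solve 3 (λ a b c → a :* (b :* c) := b :* (a :* c)) refl (x j) t (y j)))
                            (sym (*-distribˡ-Σ n t _))

  dot-+ᵛˡ : ∀ {n} (x y z : V n) → dot (x +ᵛ y) z ≈ dot x z + dot y z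
  dot-+ᵛˡ {n} x y z = trans (Σ-cong n (λ j → distribʳ (z j) (x j) (y j))) (Σ-distrib-+ n _ _)

  dot-Σʳ : ∀ {n} r (x : V n) (z : Fin r → V n) → dot x (λ i → Σ[ r ] (λ k → z k i)) ≈ Σ[ r ] (λ k → dot x (z k))
  dot-Σʳ {n} r x z = trans (Σ-cong n (λ i → *-distribˡ-Σ r (x i) _)) (Σ-comm n r _)

  ⊙-cong : ∀ {m n} {x y : V m} {A B : Mat m n} → x ≐ y → A ≋ B → (x ⊙ A) ≐ (y ⊙ B)
  ⊙-cong {m} x≐y A≋B k = Σ-cong m (λ j → *-cong (x≐y j) (A≋B j k))

  ⊙-congˡ : ∀ {m n} (x : V m) {A B : Mat m n} → A ≋ B → (x ⊙ A) ≐ (x ⊙ B)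
  ⊙-congˡ x = ⊙-cong (≐-refl {x = x})

  ⊙-assoc : ∀ {m n p} (x : V m) (A : Mat m n) (B : Mat n p) → ((x ⊙ A) ⊙ B) ≐ (x ⊙ (A · B))
  ⊙-assoc x A B = ·-assoc (row x) A B zero

  ⊙-identityʳ : ∀ {n} (x : V n) → (x ⊙ I) ≐ x
  ⊙-identityʳ {n} x k = Σ-selectʳ n k x

  ⊙-distrib-+ᵛ : ∀ {m n} (x y : V m) (A : Mat m n) → ((x +ᵛ y) ⊙ A) ≐ (x ⊙ A +ᵛ y ⊙ A)
  ⊙-distrib-+ᵛ {m} x y A k = trans (Σ-cong m (λ j → distribʳ (A j k) (x j) (y j))) (Σ-distrib-+ m _ _)

  ⊙-neg : ∀ {m n} (x : V m) (A : Mat m n) → ((-ᵛ x) ⊙ A) ≐ (-ᵛ (x ⊙ A))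
  ⊙-neg {m} x A k = trans (Σ-cong m (λ j → sym (-‿distribˡ-* (x j) (A j k)))) (Σ-neg m _)

  T : ∀ {n} → V n → V n → Mat n n
  T p q i j = I i j + p i * q j

  T-cong : ∀ {n} {p p' q q' : V n} → p ≐ p' → q ≐ q' → T p q ≋ T p' q'
  T-cong p≐p' q≐q' i j = +-congˡ (*-cong (p≐p' i) (q≐q' j))

  T-zeroˡ : ∀ {n} {p q : V n} → (∀ i → p i ≈ 0#) → T p q ≋ I
  T-zeroˡ p≈0 i j = +-identityʳ-≈ (*-zeroˡ-≈ (p≈0 i))

  T-zeroʳ : ∀ {n} {p q : V n} → (∀ j → q j ≈ 0#) → T p q ≋ I
  T-zeroʳ q≈0 i j = +-identityʳ-≈ (*-zeroʳ-≈ (q≈0 j))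

  T-·-T : ∀ {n} (p q r s : V n) →
    (T p q · T r s) ≋ (λ i k → I i k + (p i * q k + r i * s k + dot q r * (p i * s k)))
  T-·-T {n} p q r s i k = begin
    Σ[ n ] (λ m → (I i m + p i * q m) * (I m k + r m * s k))
      ≈⟨ Σ-cong n (λ m → solve 6 (λ a b c d x y → (a :+ b :* c) :* (d :+ x :* y)
             := ((a :* d :+ a :* (x :* y)) :+ (b :* c :* d :+ b :* y :* (c :* x)))) refl
             (I i m) (p i) (q m) (I m k) (r m) (s k)) ⟩
    Σ[ n ] (λ m → (I i m * I m k + I i m * (r m * s k)) + (p i * q m * I m k + p i * s k * (q m * r m)))
      ≈⟨ trans (Σ-distrib-+ n _ _) (+-cong (Σ-distrib-+ n _ _) (Σ-distrib-+ n _ _)) ⟩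
    (Σ[ n ] (λ m → I i m * I m k) + Σ[ n ] (λ m → I i m * (r m * s k))) +
      (Σ[ n ] (λ m → p i * q m * I m k) + Σ[ n ] (λ m → p i * s k * (q m * r m)))
      ≈⟨ +-cong (+-cong (Σ-selectˡ n i (λ m → I m k)) (Σ-selectˡ n i (λ m → r m * s k)))
                (+-cong (Σ-selectʳ n k (λ m → p i * q m)) (sym (*-distribˡ-Σ n (p i * s k) _))) ⟩
    (I i k + r i * s k) + (p i * q k + p i * s k * dot q r)
      ≈⟨ solve 6 (λ a b c d x z → (a :+ b :* c) :+ (d :* x :+ d :* c :* z)
             := (a :+ ((d :* x :+ b :* c) :+ z :* (d :* c)))) refl
             (I i k) (r i) (s k) (p i) (q k) (dot q r) ⟩
    I i k + (p i * q k + r i * s k + dot q r * (p i * s k)) ∎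
    where open ≈-Reasoning

  T-·-T-comm : ∀ {n} (p q r s : V n) → dot q r ≈ 0# → dot s p ≈ 0# → (T p q · T r s) ≋ (T r s · T p q)
  T-·-T-comm p q r s q·r≈0 s·p≈0 i k = begin
    (T p q · T r s) i k                                         ≈⟨ T-·-T p q r s i k ⟩
    I i k + (p i * q k + r i * s k + dot q r * (p i * s k))     ≈⟨ +-congˡ (+-congˡ (*-zeroˡ-≈ q·r≈0)) ⟩
    I i k + (p i * q k + r i * s k + 0#)                        ≈⟨ +-congˡ (+-congʳ (+-comm _ _)) ⟩
    I i k + (r i * s k + p i * q k + 0#)                        ≈⟨ +-congˡ (+-congˡ (*-zeroˡ-≈ s·p≈0)) ⟨
    I i k + (r i * s k + p i * q k + dot s p * (r i * q k))     ≈⟨ T-·-T r s p q i k ⟨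
    (T r s · T p q) i k                                         ∎
    where open ≈-Reasoning

  T-·-T-sameʳ : ∀ {n} (p p' q : V n) → dot q p' ≈ 0# → (T p q · T p' q) ≋ T (p +ᵛ p') q
  T-·-T-sameʳ p p' q q·p'≈0 i k = begin
    (T p q · T p' q) i k                                        ≈⟨ T-·-T p q p' q i k ⟩
    I i k + (p i * q k + p' i * q k + dot q p' * (p i * q k))   ≈⟨ +-congˡ (+-congˡ (*-zeroˡ-≈ q·p'≈0)) ⟩
    I i k + (p i * q k + p' i * q k + 0#)                       ≈⟨ +-congˡ (trans (+-identityʳ _) (sym (distribʳ _ _ _))) ⟩
    T (p +ᵛ p') q i k                                           ∎
    where open ≈-Reasoning

  T-·-T-sameˡ : ∀ {n} (p q q' : V n) → dot q p ≈ 0# → (T p q · T p q') ≋ T p (q +ᵛ q')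
  T-·-T-sameˡ p q q' q·p≈0 i k = begin
    (T p q · T p q') i k                                        ≈⟨ T-·-T p q p q' i k ⟩
    I i k + (p i * q k + p i * q' k + dot q p * (p i * q' k))   ≈⟨ +-congˡ (+-congˡ (*-zeroˡ-≈ q·p≈0)) ⟩
    I i k + (p i * q k + p i * q' k + 0#)                       ≈⟨ +-congˡ (trans (+-identityʳ _) (sym (distribˡ _ _ _))) ⟩
    T p (q +ᵛ q') i k                                           ∎
    where open ≈-Reasoning

  T-commutator : ∀ {n} (p q r s : V n) → dot s p ≈ 0# → dot s r ≈ 0# →
    (T p q · T r s) ≋ (T (dot q r *ᵛ p) s · (T r s · T p q))
  T-commutator p q r s s·p≈0 s·r≈0 = begin
    T p q · T r s                                     ≈⟨ lhs-expanded ⟩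
    T (dot q r *ᵛ p +ᵛ r) s · T p q                   ≈⟨ ·-cong (T-·-T-sameʳ (dot q r *ᵛ p) r s s·r≈0) ≋-refl ⟨
    (T (dot q r *ᵛ p) s · T r s) · T p q              ≈⟨ ·-assoc (T (dot q r *ᵛ p) s) (T r s) (T p q) ⟩
    T (dot q r *ᵛ p) s · (T r s · T p q)              ∎
    where
    open ≋-Reasoning
    lhs-expanded : (T p q · T r s) ≋ (T (dot q r *ᵛ p +ᵛ r) s · T p q)
    lhs-expanded i k = ≈.begin
      (T p q · T r s) i k
        ≈.≈⟨ T-·-T p q r s i k ⟩
      I i k + (p i * q k + r i * s k + dot q r * (p i * s k))
        ≈.≈⟨ +-congˡ (trans (solve 5 (λ a b c d x → (b :* x :+ c :* d :+ a :* (b :* d)) := ((a :* b :+ c) :* d :+ b :* x))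
                 refl (dot q r) (p i) (r i) (s k) (q k)) (sym (+-identityʳ _))) ⟩
      I i k + ((dot q r * p i + r i) * s k + p i * q k + 0#)
        ≈.≈⟨ +-congˡ (+-congˡ (*-zeroˡ-≈ s·p≈0)) ⟨
      I i k + ((dot q r * p i + r i) * s k + p i * q k + dot s p * ((dot q r * p i + r i) * q k))
        ≈.≈⟨ T-·-T (dot q r *ᵛ p +ᵛ r) s p q i k ⟨
      (T (dot q r *ᵛ p +ᵛ r) s · T p q) i k ≈.∎
      where module ≈ = ≈-Reasoning

  ⊙-T : ∀ {n} (x p q : V n) → (x ⊙ T p q) ≐ (x +ᵛ dot x p *ᵛ q)
  ⊙-T {n} x p q l = begin
    Σ[ n ] (λ m → x m * (I m l + p m * q l))
      ≈⟨ Σ-cong n (λ m → solve 4 (λ a b c d → a :* (b :+ c :* d) := a :* b :+ a :* c :* d)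
                                refl (x m) (I m l) (p m) (q l)) ⟩
    Σ[ n ] (λ m → x m * I m l + x m * p m * q l)
      ≈⟨ Σ-distrib-+ n _ _ ⟩
    Σ[ n ] (λ m → x m * I m l) + Σ[ n ] (λ m → x m * p m * q l)
      ≈⟨ +-cong (Σ-selectʳ n l x) (sym (*-distribʳ-Σ n (q l) _)) ⟩
    x l + dot x p * q l ∎
    where open ≈-Reasoning

  T-· : ∀ {n} (p q : V n) (A : Mat n n) → (T p q · A) ≋ (λ r s → A r s + p r * (q ⊙ A) s)
  T-· {n} p q A r s = begin
    Σ[ n ] (λ m → (I r m + p r * q m) * A m s)
      ≈⟨ Σ-cong n (λ m → solve 4 (λ a b c d → (a :+ b :* c) :* d := a :* d :+ b :* (c :* d))
                                refl (I r m) (p r) (q m) (A m s)) ⟩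
    Σ[ n ] (λ m → I r m * A m s + p r * (q m * A m s))
      ≈⟨ Σ-distrib-+ n _ _ ⟩
    Σ[ n ] (λ m → I r m * A m s) + Σ[ n ] (λ m → p r * (q m * A m s))
      ≈⟨ +-cong (Σ-selectˡ n r (λ m → A m s)) (sym (*-distribˡ-Σ n (p r) _)) ⟩
    A r s + p r * (q ⊙ A) s ∎
    where open ≈-Reasoning

  ·-T : ∀ {n} (A : Mat n n) (p q : V n) → (A · T p q) ≋ (λ r s → A r s + (A ⊛ p) r * q s)
  ·-T {n} A p q r s = begin
    Σ[ n ] (λ m → A r m * (I m s + p m * q s))
      ≈⟨ Σ-cong n (λ m → solve 4 (λ a b c d → a :* (b :+ c :* d) := a :* b :+ a :* c :* d)
                                refl (A r m) (I m s) (p m) (q s)) ⟩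
    Σ[ n ] (λ m → A r m * I m s + A r m * p m * q s)
      ≈⟨ Σ-distrib-+ n _ _ ⟩
    Σ[ n ] (λ m → A r m * I m s) + Σ[ n ] (λ m → A r m * p m * q s)
      ≈⟨ +-cong (Σ-selectʳ n s (A r)) (sym (*-distribʳ-Σ n (q s) _)) ⟩
    A r s + (A ⊛ p) r * q s ∎
    where open ≈-Reasoning

  T-conj : ∀ {n} {A B : Mat n n} (p q : V n) → (B · A) ≋ I → (A · T p q) ≋ (T (A ⊛ p) (q ⊙ B) · A)
  T-conj {A = A} {B} p q BA≋I r s = begin
    (A · T p q) r s                         ≈⟨ ·-T A p q r s ⟩
    A r s + (A ⊛ p) r * q s                 ≈⟨ +-congˡ (*-congˡ (⊙-identityʳ q s)) ⟨
    A r s + (A ⊛ p) r * (q ⊙ I) s           ≈⟨ +-congˡ (*-congˡ (⊙-congˡ q BA≋I s)) ⟨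
    A r s + (A ⊛ p) r * (q ⊙ (B · A)) s     ≈⟨ +-congˡ (*-congˡ (⊙-assoc q B A s)) ⟨
    A r s + (A ⊛ p) r * ((q ⊙ B) ⊙ A) s     ≈⟨ T-· (A ⊛ p) (q ⊙ B) A r s ⟨
    (T (A ⊛ p) (q ⊙ B) · A) r s             ∎
    where open ≈-Reasoning

  Π[_] : ∀ {n} r → (Fin r → Mat n n) → Mat n n
  Π[ zero ] f = I
  Π[ suc r ] f = f zero · Π[ r ] (f ∘ suc)

  Π-cong : ∀ {n} r {f g : Fin r → Mat n n} → (∀ k → f k ≋ g k) → Π[ r ] f ≋ Π[ r ] g
  Π-cong zero f≋g = ≋-refl
  Π-cong (suc r) f≋g = ·-cong (f≋g zero) (Π-cong r (f≋g ∘ suc))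

  Π-T-sameʳ : ∀ {n} r (z : Fin r → V n) (w : V n) → (∀ k → dot w (z k) ≈ 0#) →
    Π[ r ] (λ k → T (z k) w) ≋ T (λ i → Σ[ r ] (λ k → z k i)) w
  Π-T-sameʳ zero z w w·z≈0 = ≋-sym (T-zeroˡ (λ i → refl))
  Π-T-sameʳ (suc r) z w w·z≈0 = ≋-trans (·-cong ≋-refl (Π-T-sameʳ r (z ∘ suc) w (w·z≈0 ∘ suc)))
    (T-·-T-sameʳ (z zero) _ w (trans (dot-Σʳ r w (z ∘ suc)) (Σ-zero r (w·z≈0 ∘ suc))))

  Π-T-sameˡ : ∀ {n} r (p : V n) (q : Fin r → V n) → (∀ k → dot (q k) p ≈ 0#) →
    Π[ r ] (λ k → T p (q k)) ≋ T p (λ i → Σ[ r ] (λ k → q k i))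
  Π-T-sameˡ zero p q q·p≈0 = ≋-sym (T-zeroʳ (λ i → refl))
  Π-T-sameˡ (suc r) p q q·p≈0 = ≋-trans (·-cong ≋-refl (Π-T-sameˡ r p (q ∘ suc) (q·p≈0 ∘ suc)))
    (T-·-T-sameˡ p (q zero) _ (q·p≈0 zero))

  E : ∀ {n} → Fin n → Fin n → Carrier → Mat n n
  E a b t = T (t *ᵛ I a) (I b)

  ⊙-E : ∀ {n} (x : V n) a b t → (x ⊙ E a b t) ≐ (x +ᵛ (t * x a) *ᵛ I b)
  ⊙-E x a b t l = trans (⊙-T x (t *ᵛ I a) (I b) l)
    (+-congˡ (*-congʳ (trans (dot-*ᵛʳ x (I a) t) (*-congˡ (dot-selectʳ x a)))))

  ⊙-E-off : ∀ {n} (x : V n) a b t {l} → b ≢ l → (x ⊙ E a b t) l ≈ x l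
  ⊙-E-off x a b t b≢l = trans (⊙-E x a b t _) (+-identityʳ-≈ (*-zeroʳ-≈ (reflexive (I-off b≢l))))

  ⊙-E-on : ∀ {n} (x : V n) a b t → (x ⊙ E a b t) b ≈ x b + t * x a
  ⊙-E-on x a b t = trans (⊙-E x a b t b) (+-congˡ (trans (*-congˡ (reflexive (I-diag b))) (*-identityʳ _)))

  minor : ∀ {n} → Mat (suc n) (suc n) → Fin (suc n) → Mat n n
  minor A j i k = A (suc i) (punchIn j k)

  cofactor-term : ∀ {n} → Mat (suc n) (suc n) → Fin (suc n) → Carrier
  cofactor-term A j = (sign (toℕ j) * A zero j) * det (minor A j)

  det-cong : ∀ {n} {A B : Mat n n} → A ≋ B → det A ≈ det B
  det-cong {zero} A≋B = refl
  det-cong {suc n} {A} {B} A≋B = Σ-cong (suc n) {cofactor-term A} {cofactor-term B} (λ j →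
    *-cong (*-congˡ (A≋B zero j)) (det-cong (λ i k → A≋B (suc i) (punchIn j k))))

  det-I : ∀ {n} → det {n} I ≈ 1#
  det-I {zero} = refl
  det-I {suc n} = begin
    (1# * 1#) * det {n} I + Σ[ n ] (cofactor-term I ∘ suc)  ≈⟨ +-identityʳ-≈ (Σ-zero n (λ j → *-zeroˡ-≈ (zeroʳ _))) ⟩
    (1# * 1#) * det {n} I                                  ≈⟨ *-cong (*-identityˡ 1#) (det-I {n}) ⟩
    1# * 1#                                                ≈⟨ *-identityˡ 1# ⟩
    1#                                                     ∎
    where open ≈-Reasoning

  det-zero-row : ∀ {n} (A : Mat n n) (r : Fin n) → (∀ k → A r k ≈ 0#) → det A ≈ 0#
  det-zero-row {suc n} A zero row≈0 = Σ-zero (suc n) {cofactor-term A} (λ j → *-zeroˡ-≈ (*-zeroʳ-≈ (row≈0 j)))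
  det-zero-row {suc n} A (suc r) row≈0 =
    Σ-zero (suc n) {cofactor-term A} (λ j → *-zeroʳ-≈ (det-zero-row (minor A j) r (row≈0 ∘ punchIn j)))

  det-by-cofactor₀ : ∀ {n} (A : Mat (suc n) (suc n)) → (∀ q → cofactor-term A (suc q) ≈ 0#) →
    det A ≈ A zero zero * det (minor A zero)
  det-by-cofactor₀ {n} A rest≈0 = trans (+-identityʳ-≈ (Σ-zero n rest≈0)) (*-congʳ (*-identityˡ _))

  det-E-row₀ : ∀ {n} (b : Fin n) t → det (E {suc n} zero (suc b) t) ≈ 1#
  det-E-row₀ {n} b t = begin
    det A
      ≈⟨ det-by-cofactor₀ A rest≈0 ⟩
    A zero zero * det (minor A zero)
      ≈⟨ *-cong (+-identityʳ-≈ (*-zeroʳ-≈ refl)) (trans (det-cong minor₀≋I) (det-I {n})) ⟩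
    1# * 1#
      ≈⟨ *-identityˡ 1# ⟩
    1# ∎
    where
    open ≈-Reasoning
    A : Mat (suc n) (suc n)
    A = E zero (suc b) t
    minor₀≋I : minor A zero ≋ I
    minor₀≋I i k = +-identityʳ-≈ (*-zeroˡ-≈ (*-zeroʳ-≈ refl))
    rest≈0 : ∀ q → cofactor-term A (suc q) ≈ 0#
    rest≈0 q with b ≟ q
    ... | yes ≡.refl = *-zeroʳ-≈ (det-zero-row (minor A (suc b)) b (λ k →
          trans (+-identityʳ-≈ (*-zeroˡ-≈ (*-zeroʳ-≈ refl))) (reflexive (I-off (punchInᵢ≢i (suc b) k ∘ ≡.sym)))))
    ... | no b≢q = *-zeroˡ-≈ (*-zeroʳ-≈ (trans (+-identityˡ-≈ refl) (*-zeroʳ-≈ (reflexive (I-off b≢q)))))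

  det-E-col₀ : ∀ {n} (a : Fin n) t → det (E {suc n} (suc a) zero t) ≈ 1#
  det-E-col₀ {n} a t = begin
    det A
      ≈⟨ det-by-cofactor₀ A (λ q → *-zeroˡ-≈ (*-zeroʳ-≈ (trans (+-identityˡ-≈ refl) (*-zeroʳ-≈ refl)))) ⟩
    A zero zero * det (minor A zero)
      ≈⟨ *-cong (+-identityʳ-≈ (*-zeroˡ-≈ (*-zeroʳ-≈ refl))) (trans (det-cong minor₀≋I) (det-I {n})) ⟩
    1# * 1#
      ≈⟨ *-identityˡ 1# ⟩
    1# ∎
    where
    open ≈-Reasoning
    A : Mat (suc n) (suc n)
    A = E (suc a) zero t
    minor₀≋I : minor A zero ≋ I
    minor₀≋I i k = +-identityʳ-≈ (*-zeroʳ-≈ refl)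

  record ElementaryClosed {p n} (P : Mat n n → Set p) : Set (c ⊔ ℓ ⊔ p) where
    field
      resp : ∀ {A B} → A ≋ B → P A → P B
      contains-I : P I
      closed-· : ∀ {A B} → P A → P B → P (A · B)
      closed-÷ : ∀ {A B M} → P A → P B → A ≋ (M · B) → P M
      contains-E : ∀ {a b} → a ≢ b → ∀ t → P (E a b t)

    closed-Π : ∀ r (f : Fin r → Mat n n) → (∀ k → P (f k)) → P (Π[ r ] f)
    closed-Π zero f f∈ = contains-I
    closed-Π (suc r) f f∈ = closed-· (f∈ zero) (closed-Π r (f ∘ suc) (f∈ ∘ suc))

    private
      scaled-basis-orth : ∀ k m (y : V n) → y m ≈ 0# → y k * I k m ≈ 0#
      scaled-basis-orth k m y ym≈0 with k ≟ m
      ... | yes ≡.refl = *-zeroˡ-≈ ym≈0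
      ... | no k≢m = *-zeroʳ-≈ (reflexive (I-off k≢m))

    T-col∈ : ∀ m (y : V n) → y m ≈ 0# → P (T y (I m))
    T-col∈ m y ym≈0 = resp T≋ (closed-Π n (λ k → E k m (y k)) E∈)
      where
      T≋ : Π[ n ] (λ k → E k m (y k)) ≋ T y (I m)
      T≋ = ≋-trans (Π-T-sameʳ n (λ k → y k *ᵛ I k) (I m)
                      (λ k → trans (dot-selectˡ m (y k *ᵛ I k)) (scaled-basis-orth k m y ym≈0)))
                   (T-cong (λ i → Σ-selectʳ n i y) ≐-refl)
      E∈ : ∀ k → P (E k m (y k))
      E∈ k with k ≟ m
      ... | yes ≡.refl = resp (≋-sym (T-zeroˡ (λ i → *-zeroˡ-≈ ym≈0))) contains-I
      ... | no k≢m = contains-E k≢m (y k)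

    T-row∈ : ∀ m (y : V n) → y m ≈ 0# → P (T (I m) y)
    T-row∈ m y ym≈0 = resp T≋ (closed-Π n (λ k → T (I m) (y k *ᵛ I k)) factor∈)
      where
      T≋ : Π[ n ] (λ k → T (I m) (y k *ᵛ I k)) ≋ T (I m) y
      T≋ = ≋-trans (Π-T-sameˡ n (I m) (λ k → y k *ᵛ I k)
                      (λ k → trans (dot-selectʳ (y k *ᵛ I k) m) (scaled-basis-orth k m y ym≈0)))
                   (T-cong ≐-refl (λ j → Σ-selectʳ n j y))
      factor∈ : ∀ k → P (T (I m) (y k *ᵛ I k))
      factor∈ k with k ≟ m
      ... | yes ≡.refl = resp (≋-sym (T-zeroʳ (λ j → *-zeroˡ-≈ ym≈0))) contains-I
      ... | no k≢m = resp (λ i j → +-congˡ (solve 3 (λ t a b → t :* a :* b := a :* (t :* b)) refl (y k) (I m i) (I k j)))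
                          (contains-E (k≢m ∘ ≡.sym) (y k))

    T-zeroAt∈ : ∀ m (z w : V n) → z m ≈ 0# → dot w z ≈ 0# → P (T z w)
    T-zeroAt∈ m z w zm≈0 w·z≈0 =
      resp (≋-trans (T-·-T-sameˡ z wₘ w' wₘ·z≈0) (T-cong ≐-refl wₘ+w'≐w)) (closed-· Tzwₘ∈ Tzw'∈)
      where
      wₘ w' : V n
      wₘ = w m *ᵛ I m
      w' = updateAt w m (λ _ → 0#)

      wₘ+w'≐w : (wₘ +ᵛ w') ≐ w
      wₘ+w'≐w i with i ≟ m
      ... | yes ≡.refl = trans (+-cong (trans (*-congˡ (reflexive (I-diag i))) (*-identityʳ _))
                                       (reflexive (updateAt-updates i w)))
                               (+-identityʳ _)
      ... | no i≢m = trans (+-identityˡ-≈ (*-zeroʳ-≈ (reflexive (I-off (i≢m ∘ ≡.sym)))))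
                           (reflexive (updateAt-minimal i m w i≢m))

      wₘ·z≈0 : dot wₘ z ≈ 0#
      wₘ·z≈0 = trans (dot-comm wₘ z) (trans (dot-*ᵛʳ z (I m) (w m)) (*-zeroʳ-≈ (trans (dot-selectʳ z m) zm≈0)))

      w'·z≈0 : dot w' z ≈ 0#
      w'·z≈0 = begin
        dot w' z                ≈⟨ +-identityˡ-≈ wₘ·z≈0 ⟨
        dot wₘ z + dot w' z     ≈⟨ dot-+ᵛˡ wₘ w' z ⟨
        dot (wₘ +ᵛ w') z        ≈⟨ dot-cong wₘ+w'≐w ≐-refl ⟩
        dot w z                 ≈⟨ w·z≈0 ⟩
        0#                      ∎
        where open ≈-Reasoning

      w'·Iₘ≈0 : dot w' (I m) ≈ 0#
      w'·Iₘ≈0 = trans (dot-selectʳ w' m) (reflexive (updateAt-updates m w))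

      Tzwₘ∈ : P (T z wₘ)
      Tzwₘ∈ = resp (λ i j → +-congˡ (solve 3 (λ a b c → a :* b :* c := b :* (a :* c)) refl (w m) (z i) (I m j)))
                   (T-col∈ m (w m *ᵛ z) (*-zeroʳ-≈ zm≈0))

      -- the commutator of T z eₘ and T eₘ w' is T z w', because eₘ · eₘ = 1
      Tzw'∈ : P (T z w')
      Tzw'∈ = resp (T-cong (λ i → trans (*-congʳ (trans (dot-selectʳ (I m) m) (reflexive (I-diag m)))) (*-identityˡ _)) ≐-refl)
                   (closed-÷ (closed-· (T-col∈ m z zm≈0) (T-row∈ m w' (reflexive (updateAt-updates m w))))
                             (closed-· (T-row∈ m w' (reflexive (updateAt-updates m w))) (T-col∈ m z zm≈0))
                             (T-commutator z (I m) (I m) w' w'·z≈0 w'·Iₘ≈0))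

    T∈ : 2 < n → (v w x : V n) → dot w v ≈ 0# → dot w x ≈ 1# → P (T v w)
    T∈ 2<n v w x w·v≈0 w·x≈1 =
      resp T≋ (closed-Π n _ (λ k → closed-Π n _ (λ l →
        let m , m∉ = fresh 2<n (k ∷ l ∷ []) in
        T-zeroAt∈ m (z k l) w (*-zeroʳ-≈ (pair-outside (m∉ zero) (m∉ (suc zero)))) (w·z≈0 k l))))
      where
      -- v = Σₖ Σₗ vₖ xₗ (wₗ eₖ − wₖ eₗ) as w·x = 1 and w·v = 0; each summand is orthogonal to w
      -- and vanishes outside {k, l}
      pair : Fin n → Fin n → V n
      pair k l i = w l * I k i - w k * I l i

      pair-outside : ∀ {k l m} → m ≢ k → m ≢ l → pair k l m ≈ 0#
      pair-outside m≢k m≢l = trans (+-cong (*-zeroʳ-≈ (reflexive (I-off (m≢k ∘ ≡.sym))))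
                                           (-‿cong (*-zeroʳ-≈ (reflexive (I-off (m≢l ∘ ≡.sym))))))
                                   (trans (+-identityˡ _) ε⁻¹≈ε)

      w·pair≈0 : ∀ k l → dot w (pair k l) ≈ 0#
      w·pair≈0 k l = begin
        dot w (pair k l)
          ≈⟨ Σ-cong n (λ i → x[y-z]≈xy-xz (w i) _ _) ⟩
        Σ[ n ] (λ i → w i * (w l * I k i) - w i * (w k * I l i))
          ≈⟨ Σ-distrib-minus n _ _ ⟩
        dot w (w l *ᵛ I k) - dot w (w k *ᵛ I l)
          ≈⟨ +-cong (dot-*ᵛʳ w (I k) (w l)) (-‿cong (dot-*ᵛʳ w (I l) (w k))) ⟩
        w l * dot w (I k) - w k * dot w (I l)
          ≈⟨ +-cong (*-congˡ (dot-selectʳ w k)) (-‿cong (*-congˡ (dot-selectʳ w l))) ⟩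
        w l * w k - w k * w l
          ≈⟨ +-congˡ (-‿cong (*-comm (w k) (w l))) ⟩
        w l * w k - w l * w k
          ≈⟨ -‿inverseʳ _ ⟩
        0# ∎
        where open ≈-Reasoning

      z : Fin n → Fin n → V n
      z k l = (v k * x l) *ᵛ pair k l

      w·z≈0 : ∀ k l → dot w (z k l) ≈ 0#
      w·z≈0 k l = trans (dot-*ᵛʳ w (pair k l) (v k * x l)) (*-zeroʳ-≈ (w·pair≈0 k l))

      Σz-inner : ∀ k i → Σ[ n ] (λ l → z k l i) ≈ (v k * I k i) * dot x w - x i * (v k * w k)
      Σz-inner k i = begin
        Σ[ n ] (λ l → (v k * x l) * (w l * I k i - w k * I l i))
          ≈⟨ Σ-cong n (λ l → trans (x[y-z]≈xy-xz _ _ _) (+-cong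
               (solve 4 (λ a b c d → a :* b :* (c :* d) := a :* d :* (b :* c)) refl (v k) (x l) (w l) (I k i))
               (-‿cong (solve 4 (λ a b c d → a :* b :* (c :* d) := b :* d :* (a :* c)) refl (v k) (x l) (w k) (I l i))))) ⟩
        Σ[ n ] (λ l → (v k * I k i) * (x l * w l) - (x l * I l i) * (v k * w k))
          ≈⟨ Σ-distrib-minus n _ _ ⟩
        Σ[ n ] (λ l → (v k * I k i) * (x l * w l)) - Σ[ n ] (λ l → (x l * I l i) * (v k * w k))
          ≈⟨ +-cong (sym (*-distribˡ-Σ n (v k * I k i) _))
                    (-‿cong (trans (sym (*-distribʳ-Σ n (v k * w k) _)) (*-congʳ (Σ-selectʳ n i x)))) ⟩
        (v k * I k i) * dot x w - x i * (v k * w k) ∎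
        where open ≈-Reasoning

      Σz≐v : (λ i → Σ[ n ] (λ k → Σ[ n ] (λ l → z k l i))) ≐ v
      Σz≐v i = begin
        Σ[ n ] (λ k → Σ[ n ] (λ l → z k l i))
          ≈⟨ Σ-cong n (λ k → Σz-inner k i) ⟩
        Σ[ n ] (λ k → (v k * I k i) * dot x w - x i * (v k * w k))
          ≈⟨ Σ-distrib-minus n _ _ ⟩
        Σ[ n ] (λ k → (v k * I k i) * dot x w) - Σ[ n ] (λ k → x i * (v k * w k))
          ≈⟨ +-cong (sym (*-distribʳ-Σ n (dot x w) _)) (-‿cong (sym (*-distribˡ-Σ n (x i) _))) ⟩
        Σ[ n ] (λ k → v k * I k i) * dot x w - x i * dot v w
          ≈⟨ +-cong (*-cong (Σ-selectʳ n i v) (trans (dot-comm x w) w·x≈1))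
                    (-‿cong (*-zeroʳ-≈ (trans (dot-comm v w) w·v≈0))) ⟩
        v i * 1# - 0#
          ≈⟨ trans (+-congʳ (*-identityʳ _)) (+-identityʳ-≈ ε⁻¹≈ε) ⟩
        v i ∎
        where open ≈-Reasoning

      T≋ : Π[ n ] (λ k → Π[ n ] (λ l → T (z k l) w)) ≋ T v w
      T≋ = ≋-trans (Π-cong n (λ k → Π-T-sameʳ n (z k) w (w·z≈0 k)))
           (≋-trans (Π-T-sameʳ n (λ k i → Σ[ n ] (λ l → z k l i)) w
                      (λ k → trans (dot-Σʳ n w (z k)) (Σ-zero n (w·z≈0 k))))
                    (T-cong Σz≐v ≐-refl))

  top : ∀ {n} → Mat (suc n) (suc n) → V n
  top g k = g zero (suc k)

  block-cong : ∀ {n} {x y : V n} {A B : Mat n n} → x ≐ y → A ≋ B → block (row x) A ≋ block (row y) B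
  block-cong x≐y A≋B zero zero = refl
  block-cong x≐y A≋B zero (suc k) = x≐y k
  block-cong x≐y A≋B (suc i) zero = refl
  block-cong x≐y A≋B (suc i) (suc k) = A≋B i k

  block-· : ∀ {n} (x y : V n) (A B : Mat n n) →
    (block (row x) A · block (row y) B) ≋ block (row (y +ᵛ x ⊙ B)) (A · B)
  block-· {n} x y A B zero zero = trans (+-identityʳ-≈ (Σ-zero n (λ _ → zeroʳ _))) (*-identityˡ 1#)
  block-· {n} x y A B zero (suc k) = +-congʳ (*-identityˡ _)
  block-· {n} x y A B (suc i) zero = trans (+-identityˡ-≈ (zeroˡ _)) (Σ-zero n (λ _ → zeroʳ _))
  block-· {n} x y A B (suc i) (suc k) = +-identityˡ-≈ (zeroˡ _)

  block-0-I : ∀ {n} → block (row (λ _ → 0#)) (I {n}) ≋ I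
  block-0-I zero zero = refl
  block-0-I zero (suc k) = refl
  block-0-I (suc i) zero = refl
  block-0-I (suc i) (suc k) = refl

  π-· : ∀ {n} {g : Mat (suc n) (suc n)} (h : Mat (suc n) (suc n)) → InT g → π (g · h) ≋ (π g · π h)
  π-· h (_ , _ , _ , g≋) i k = +-identityˡ-≈ (*-zeroˡ-≈ (g≋ (suc i) zero))

  top-· : ∀ {n} {g : Mat (suc n) (suc n)} (h : Mat (suc n) (suc n)) → InT g → top (g · h) ≐ (top h +ᵛ top g ⊙ π h)
  top-· h (_ , _ , _ , g≋) k = +-congʳ (trans (*-congʳ (g≋ zero zero)) (*-identityˡ _))

  defect : ∀ {n} → V n → Mat (suc n) (suc n) → V n
  defect u g k = top g k + u k - (u ⊙ π g) k

  defect-cong : ∀ {n} (u : V n) {g h : Mat (suc n) (suc n)} → g ≋ h → defect u g ≐ defect u h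
  defect-cong u g≋h k = +-cong (+-congʳ (g≋h zero (suc k))) (-‿cong (⊙-congˡ u (λ i j → g≋h (suc i) (suc j)) k))

  defect-· : ∀ {n} (u : V n) {g : Mat (suc n) (suc n)} (h : Mat (suc n) (suc n)) → InT g →
    defect u (g · h) ≐ (defect u h +ᵛ defect u g ⊙ π h)
  defect-· u {g} h g∈T k = begin
    top (g · h) k + u k - (u ⊙ π (g · h)) k
      ≈⟨ +-cong (+-congʳ (top-· h g∈T k)) (-‿cong (trans (⊙-congˡ u (π-· h g∈T) k) (sym (⊙-assoc u (π g) (π h) k)))) ⟩
    (a + b) + uₖ - d
      ≈⟨ shuffle ⟩
    (a + uₖ - e) + (b + e - d)
      ≈⟨ +-congˡ (sym (trans (⊙-distrib-+ᵛ (top g +ᵛ u) _ (π h) k)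
                       (+-cong (⊙-distrib-+ᵛ (top g) u (π h) k) (⊙-neg (u ⊙ π g) (π h) k)))) ⟩
    defect u h k + (defect u g ⊙ π h) k ∎
    where
    open ≈-Reasoning
    a b uₖ d e : Carrier
    a = top h k
    b = (top g ⊙ π h) k
    uₖ = u k
    d = ((u ⊙ π g) ⊙ π h) k
    e = (u ⊙ π h) k
    shuffle : (a + b) + uₖ - d ≈ (a + uₖ - e) + (b + e - d)
    shuffle = begin
      (a + b) + uₖ - d                   ≈⟨ +-identityʳ _ ⟨
      (a + b) + uₖ - d + 0#              ≈⟨ +-congˡ (-‿inverseʳ e) ⟨
      (a + b) + uₖ - d + (e - e)         ≈⟨ solve 6 (λ a b c d e -e → a :+ b :+ c :+ d :+ (e :+ -e)
                                                                    := (a :+ c :+ -e) :+ (b :+ e :+ d))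
                                                    refl a b uₖ (- d) e (- e) ⟩
      (a + uₖ - e) + (b + e - d)         ∎

  shear : ∀ {n} → V n → Mat (suc n) (suc n)
  shear u = block (row u) I

  shear-InT : ∀ {n} (u : V n) → InT (shear u)
  shear-InT u = row u , I , (I , ·-identityˡ I , ·-identityˡ I) , ≋-refl

  shear-inverse : ∀ {n} (u v : V n) → (∀ k → u k + v k ≈ 0#) → (shear u · shear v) ≋ I
  shear-inverse u v u+v≈0 = ≋-trans (block-· u v I I)
    (≋-trans (block-cong (λ k → trans (+-congˡ (⊙-identityʳ u k)) (trans (+-comm _ _) (u+v≈0 k))) (·-identityˡ I)) block-0-I)

  shear-conjugate : ∀ {n} (u : V n) {g : Mat (suc n) (suc n)} → InT g → (∀ k → defect u g k ≈ 0#) →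
    InD ((shear (-ᵛ u) · g) · shear u)
  shear-conjugate u {g} (x , A , A∈GL , g≋) defect≈0 = A , A∈GL , (begin
    (shear (-ᵛ u) · g) · shear u
      ≈⟨ ·-cong (·-cong (≋-refl {A = shear (-ᵛ u)}) g≋) (≋-refl {A = shear u}) ⟩
    (shear (-ᵛ u) · block x A) · shear u
      ≈⟨ ·-cong (block-· (-ᵛ u) (x zero) I A) (≋-refl {A = shear u}) ⟩
    block (row (x zero +ᵛ (-ᵛ u) ⊙ A)) (I · A) · shear u
      ≈⟨ block-· (x zero +ᵛ (-ᵛ u) ⊙ A) u (I · A) I ⟩
    block (row (u +ᵛ (x zero +ᵛ (-ᵛ u) ⊙ A) ⊙ I)) ((I · A) · I)
      ≈⟨ block-cong top≈0 (≋-trans (·-identityʳ _) (·-identityˡ A)) ⟩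
    block (λ _ _ → 0#) A ∎)
    where
    open ≋-Reasoning
    top≈0 : (u +ᵛ (x zero +ᵛ (-ᵛ u) ⊙ A) ⊙ I) ≐ (λ _ → 0#)
    top≈0 k = ≈.begin
      u k + ((x zero +ᵛ (-ᵛ u) ⊙ A) ⊙ I) k  ≈.≈⟨ +-congˡ (⊙-identityʳ _ k) ⟩
      u k + (x zero k + ((-ᵛ u) ⊙ A) k)      ≈.≈⟨ +-congˡ (+-cong (sym (g≋ zero (suc k))) (⊙-neg u A k)) ⟩
      u k + (top g k - (u ⊙ A) k)            ≈.≈⟨ solve 3 (λ a b c → a :+ (b :+ c) := b :+ a :+ c)
                                                          refl (u k) (top g k) (- (u ⊙ A) k) ⟩
      top g k + u k - (u ⊙ A) k              ≈.≈⟨ +-congˡ (-‿cong (⊙-congˡ u (λ i j → g≋ (suc i) (suc j)) k)) ⟨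
      defect u g k                           ≈.≈⟨ defect≈0 k ⟩
      0#                                     ≈.∎
      where module ≈ = ≈-Reasoning

  ⊙-zeroˡ : ∀ {m n} {x : V m} (A : Mat m n) → (∀ i → x i ≈ 0#) → ∀ k → (x ⊙ A) k ≈ 0#
  ⊙-zeroˡ {m} A x≈0 k = Σ-zero m (λ j → *-zeroˡ-≈ (x≈0 j))

module Splitting {c ℓ p : Level} (F : Field c ℓ) (n : ℕ) (3<n : 3 < n)
  (Γ : FieldMatrices.Mat F (suc n) (suc n) → Set p)
  (Γ-subgroup : FieldMatrices.IsSubgroup F Γ)
  (Γ⊆T : ∀ g → Γ g → FieldMatrices.InT F g)
  (π-injective : ∀ g h → Γ g → Γ h → FieldMatrices._≋_ F (FieldMatrices.π F g) (FieldMatrices.π F h) →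
                 FieldMatrices._≋_ F g h)
  (SL⊆πΓ : ∀ A → FieldMatrices.IsSL F A →
           Σ (FieldMatrices.Mat F (suc n) (suc n)) (λ g → Γ g × FieldMatrices._≋_ F (FieldMatrices.π F g) A))
  where

  open Field F hiding (zero)
  open FieldMatrices F
  open Linear F
  open import Algebra.Properties.Group +-group using (∙-cancelˡ)
  open IsSubgroup Γ-subgroup using () renaming (has-I to Γ-I; closed-· to Γ-·; has-inv to Γ-inv)

  M : Set c
  M = Mat (suc n) (suc n)

  top-unique : ∀ {g h} → Γ g → Γ h → π g ≋ π h → top g ≐ top h
  top-unique {g} {h} g∈Γ h∈Γ πg≋πh k = π-injective g h g∈Γ h∈Γ πg≋πh zero (suc k)

  π-·-inverse : ∀ {g} h → Γ g → (g · h) ≋ I → (π g · π h) ≋ I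
  π-·-inverse {g} h g∈Γ gh≋I = ≋-trans (≋-sym (π-· h (Γ⊆T g g∈Γ))) (λ i j → gh≋I (suc i) (suc j))

  module Lifting {q} (Q : M → Set q) (Q-I : Q I)
    (Q-· : ∀ {g h} → Γ g → Q g → Q h → Q (g · h))
    (Q-inverse : ∀ {g h} → Γ g → (g · h) ≋ I → Q g → Q h) where

    Lift : Mat n n → Set (c ⊔ ℓ ⊔ p ⊔ q)
    Lift A = Σ M (λ g → Γ g × (π g ≋ A) × Q g)

    lift-resp : ∀ {A B} → A ≋ B → Lift A → Lift B
    lift-resp A≋B (g , g∈Γ , πg≋A , Qg) = g , g∈Γ , ≋-trans πg≋A A≋B , Qg

    lift-I : Lift I
    lift-I = I , Γ-I , ≋-refl , Q-I

    lift-· : ∀ {A B} → Lift A → Lift B → Lift (A · B)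
    lift-· (g , g∈Γ , πg≋A , Qg) (h , h∈Γ , πh≋B , Qh) =
      g · h , Γ-· g∈Γ h∈Γ , ≋-trans (π-· h (Γ⊆T g g∈Γ)) (·-cong πg≋A πh≋B) , Q-· g∈Γ Qg Qh

    lift-inverse : ∀ {A} → Lift A → Σ (Mat n n) (λ B → Lift B × (A · B) ≋ I)
    lift-inverse (g , g∈Γ , πg≋A , Qg) =
      let h , h∈Γ , gh≋I , _ = Γ-inv g∈Γ in
      π h , (h , h∈Γ , ≋-refl , Q-inverse g∈Γ gh≋I Qg) ,
      ≋-trans (·-cong (≋-sym πg≋A) (≋-refl {A = π h})) (π-·-inverse h g∈Γ gh≋I)

    lift-÷ : ∀ {A B C} → Lift A → Lift B → A ≋ (C · B) → Lift C
    lift-÷ {A} {B} {C} liftA liftB A≋CB =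
      let B⁻¹ , liftB⁻¹ , BB⁻¹≋I = lift-inverse liftB in
      lift-resp (begin
        A · B⁻¹          ≈⟨ ·-cong A≋CB (≋-refl {A = B⁻¹}) ⟩
        (C · B) · B⁻¹    ≈⟨ ·-assoc C B B⁻¹ ⟩
        C · (B · B⁻¹)    ≈⟨ ·-cong (≋-refl {A = C}) BB⁻¹≋I ⟩
        C · I            ≈⟨ ·-identityʳ C ⟩
        C                ∎) (lift-· liftA liftB⁻¹)
      where open ≋-Reasoning

  module Plain = Lifting (λ _ → ⊤) tt (λ _ _ _ → tt) (λ _ _ _ → tt)

  lift-SL : ∀ {A} → IsSL A → Plain.Lift A
  lift-SL A∈SL = let g , g∈Γ , πg≋A = SL⊆πΓ _ A∈SL in g , g∈Γ , πg≋A , tt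

  -- Only elementary matrices with an index 0 have their determinant computed directly;
  -- E (a+1) (b+1) t is the commutator of E (a+1) 0 t and E 0 (b+1) 1.
  lift-E : ∀ {a b} → a ≢ b → ∀ t → Plain.Lift (E a b t)
  lift-E {zero} {zero} a≢b t = ⊥-elim (a≢b ≡.refl)
  lift-E {zero} {suc b} a≢b t = lift-SL (det-E-row₀ b t)
  lift-E {suc a} {zero} a≢b t = lift-SL (det-E-col₀ a t)
  lift-E {suc a} {suc b} a≢b t =
    Plain.lift-resp E≋ (Plain.lift-÷ (Plain.lift-· lift-col lift-row) (Plain.lift-· lift-row lift-col)
      (T-commutator (t *ᵛ I (suc a)) e₀ e₀ (I (suc b))
        (trans (dot-selectˡ (suc b) (t *ᵛ I (suc a))) (*-zeroʳ-≈ (reflexive (I-off a≢b))))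
        (dot-selectˡ (suc b) e₀)))
    where
    e₀ : V n
    e₀ = I zero
    lift-col : Plain.Lift (E (suc a) zero t)
    lift-col = lift-SL (det-E-col₀ a t)
    lift-row : Plain.Lift (T e₀ (I (suc b)))
    lift-row = Plain.lift-resp (T-cong (λ i → *-identityˡ _) ≐-refl) (lift-SL (det-E-row₀ b 1#))
    E≋ : T (dot e₀ e₀ *ᵛ (t *ᵛ I (suc a))) (I (suc b)) ≋ E (suc a) (suc b) t
    E≋ = T-cong (λ i → trans (*-congʳ (dot-selectˡ zero e₀)) (*-identityˡ _)) ≐-refl

  top-commute : ∀ {g h} → Γ g → Γ h → (π g · π h) ≋ (π h · π g) →
    (top h +ᵛ top g ⊙ π h) ≐ (top g +ᵛ top h ⊙ π g)
  top-commute {g} {h} g∈Γ h∈Γ πgπh≋πhπg k = begin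
    top h k + (top g ⊙ π h) k   ≈⟨ top-· h (Γ⊆T g g∈Γ) k ⟨
    top (g · h) k               ≈⟨ top-unique (Γ-· g∈Γ h∈Γ) (Γ-· h∈Γ g∈Γ) πgh≋πhg k ⟩
    top (h · g) k               ≈⟨ top-· g (Γ⊆T h h∈Γ) k ⟩
    top g k + (top h ⊙ π g) k   ∎
    where
    open ≈-Reasoning
    πgh≋πhg : π (g · h) ≋ π (h · g)
    πgh≋πhg = ≋-trans (π-· h (Γ⊆T g g∈Γ)) (≋-trans πgπh≋πhπg (≋-sym (π-· g (Γ⊆T h h∈Γ))))

  -- E i j t commutes with E m l 1 for a fourth index l, and comparing tops at l isolates top g m
  top-E-off : ∀ {i j t g} → i ≢ j → Γ g → π g ≋ E i j t → ∀ {m} → m ≢ j → top g m ≈ 0#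
  top-E-off {i} {j} {t} {g} i≢j g∈Γ πg≋E {m} m≢j =
    let l , l∉ = fresh 3<n (i ∷ j ∷ m ∷ [])
        h , h∈Γ , πh≋E , _ = lift-E (l∉ (suc (suc zero)) ∘ ≡.sym) 1#
        commute = T-·-T-comm (t *ᵛ I i) (I j) (1# *ᵛ I m) (I l)
                    (trans (dot-selectˡ j (1# *ᵛ I m)) (*-zeroʳ-≈ (reflexive (I-off m≢j))))
                    (trans (dot-selectˡ l (t *ᵛ I i)) (*-zeroʳ-≈ (reflexive (I-off (l∉ zero ∘ ≡.sym)))))
        tops = top-commute g∈Γ h∈Γ
                 (≋-trans (·-cong πg≋E πh≋E) (≋-trans commute (·-cong (≋-sym πh≋E) (≋-sym πg≋E)))) l
    in ∙-cancelˡ (top h l + top g l) _ _ (begin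
      (top h l + top g l) + top g m       ≈⟨ +-assoc _ _ _ ⟩
      top h l + (top g l + top g m)       ≈⟨ +-congˡ (+-congˡ (*-identityˡ _)) ⟨
      top h l + (top g l + 1# * top g m)  ≈⟨ +-congˡ (⊙-E-on (top g) m l 1#) ⟨
      top h l + (top g ⊙ E m l 1#) l      ≈⟨ +-congˡ (⊙-congˡ (top g) πh≋E l) ⟨
      top h l + (top g ⊙ π h) l           ≈⟨ tops ⟩
      top g l + (top h ⊙ π g) l           ≈⟨ +-congˡ (trans (⊙-congˡ (top h) πg≋E l)
                                                           (⊙-E-off (top h) i j t (l∉ (suc zero) ∘ ≡.sym))) ⟩
      top g l + top h l                   ≈⟨ +-comm _ _ ⟩
      top h l + top g l                   ≈⟨ +-identityʳ _ ⟨
      (top h l + top g l) + 0#            ∎)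
    where open ≈-Reasoning

  -- from the commutator relation E i k 1 · E k j t = E i j t · (E k j t · E i k 1)
  top-E-scale : ∀ {i j k t g₁ g₃} → i ≢ j → i ≢ k → k ≢ j →
    Γ g₁ → π g₁ ≋ E i k 1# → Γ g₃ → π g₃ ≋ E i j t → top g₃ j ≈ t * top g₁ k
  top-E-scale {i} {j} {k} {t} {g₁} {g₃} i≢j i≢k k≢j g₁∈Γ πg₁≋E g₃∈Γ πg₃≋E =
    ∙-cancelˡ (top g₂ j) _ _ (begin
      top g₂ j + top g₃ j        ≈⟨ top-g₃g₂g₁ ⟨
      top (g₃ · (g₂ · g₁)) j     ≈⟨ top-unique (Γ-· g₃∈Γ (Γ-· g₂∈Γ g₁∈Γ)) (Γ-· g₁∈Γ g₂∈Γ) (≋-sym π-g₁g₂) j ⟩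
      top (g₁ · g₂) j            ≈⟨ top-g₁g₂ ⟩
      top g₂ j + t * top g₁ k    ∎)
    where
    open ≈-Reasoning
    g₂ : M
    g₂ = proj₁ (lift-E k≢j t)
    g₂∈Γ : Γ g₂
    g₂∈Γ = proj₁ (proj₂ (lift-E k≢j t))
    πg₂≋E : π g₂ ≋ E k j t
    πg₂≋E = proj₁ (proj₂ (proj₂ (lift-E k≢j t)))

    top-g₁ : top g₁ j ≈ 0#
    top-g₁ = top-E-off i≢k g₁∈Γ πg₁≋E (k≢j ∘ ≡.sym)

    top-g₁g₂ : top (g₁ · g₂) j ≈ top g₂ j + t * top g₁ k
    top-g₁g₂ = begin
      top (g₁ · g₂) j                       ≈⟨ top-· g₂ (Γ⊆T g₁ g₁∈Γ) j ⟩
      top g₂ j + (top g₁ ⊙ π g₂) j          ≈⟨ +-congˡ (trans (⊙-congˡ (top g₁) πg₂≋E j) (⊙-E-on (top g₁) k j t)) ⟩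
      top g₂ j + (top g₁ j + t * top g₁ k)  ≈⟨ +-congˡ (+-identityˡ-≈ top-g₁) ⟩
      top g₂ j + t * top g₁ k               ∎

    top-g₃g₂g₁ : top (g₃ · (g₂ · g₁)) j ≈ top g₂ j + top g₃ j
    top-g₃g₂g₁ = begin
      top (g₃ · (g₂ · g₁)) j
        ≈⟨ top-· (g₂ · g₁) (Γ⊆T g₃ g₃∈Γ) j ⟩
      top (g₂ · g₁) j + (top g₃ ⊙ π (g₂ · g₁)) j
        ≈⟨ +-cong (top-· g₁ (Γ⊆T g₂ g₂∈Γ) j) (⊙-congˡ (top g₃) (π-· g₁ (Γ⊆T g₂ g₂∈Γ)) j) ⟩
      (top g₁ j + (top g₂ ⊙ π g₁) j) + (top g₃ ⊙ (π g₂ · π g₁)) j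
        ≈⟨ +-cong (+-identityˡ-≈ top-g₁) (sym (⊙-assoc (top g₃) (π g₂) (π g₁) j)) ⟩
      (top g₂ ⊙ π g₁) j + ((top g₃ ⊙ π g₂) ⊙ π g₁) j
        ≈⟨ +-cong (⊙-congˡ (top g₂) πg₁≋E j) (⊙-cong (⊙-congˡ (top g₃) πg₂≋E) πg₁≋E j) ⟩
      (top g₂ ⊙ E i k 1#) j + ((top g₃ ⊙ E k j t) ⊙ E i k 1#) j
        ≈⟨ +-cong (⊙-E-off (top g₂) i k 1# k≢j) (⊙-E-off (top g₃ ⊙ E k j t) i k 1# k≢j) ⟩
      top g₂ j + (top g₃ ⊙ E k j t) j
        ≈⟨ +-congˡ (⊙-E-on (top g₃) k j t) ⟩
      top g₂ j + (top g₃ j + t * top g₃ k)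
        ≈⟨ +-congˡ (+-identityʳ-≈ (*-zeroʳ-≈ (top-E-off i≢j g₃∈Γ πg₃≋E k≢j))) ⟩
      top g₂ j + top g₃ j ∎

    π-g₁g₂ : π (g₁ · g₂) ≋ π (g₃ · (g₂ · g₁))
    π-g₁g₂ = ≋.begin
      π (g₁ · g₂)                 ≋.≈⟨ π-· g₂ (Γ⊆T g₁ g₁∈Γ) ⟩
      π g₁ · π g₂                 ≋.≈⟨ ·-cong πg₁≋E πg₂≋E ⟩
      E i k 1# · E k j t          ≋.≈⟨ commutator ⟩
      E i j t · (E k j t · E i k 1#) ≋.≈⟨ ·-cong (≋-sym πg₃≋E)
                                              (≋-trans (·-cong (≋-sym πg₂≋E) (≋-sym πg₁≋E)) (≋-sym (π-· g₁ (Γ⊆T g₂ g₂∈Γ)))) ⟩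
      π g₃ · π (g₂ · g₁)          ≋.≈⟨ π-· (g₂ · g₁) (Γ⊆T g₃ g₃∈Γ) ⟨
      π (g₃ · (g₂ · g₁))          ≋.∎
      where
      module ≋ = ≋-Reasoning
      commutator : (E i k 1# · E k j t) ≋ (E i j t · (E k j t · E i k 1#))
      commutator = ≋-trans (T-commutator (1# *ᵛ I i) (I k) (t *ᵛ I k) (I j)
                             (trans (dot-selectˡ j (1# *ᵛ I i)) (*-zeroʳ-≈ (reflexive (I-off i≢j))))
                             (trans (dot-selectˡ j (t *ᵛ I k)) (*-zeroʳ-≈ (reflexive (I-off k≢j)))))
                           (·-cong (T-cong (λ x → *-cong dot≈t (*-identityˡ _)) ≐-refl) ≋-refl)
        where
        dot≈t : dot (I k) (t *ᵛ I k) ≈ t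
        dot≈t = trans (dot-selectˡ k (t *ᵛ I k)) (trans (*-congˡ (reflexive (I-diag k))) (*-identityʳ t))

  partner : Fin n → Fin n
  partner i = proj₁ (fresh (<⇒≤ (<⇒≤ 3<n)) (i ∷ []))

  partner≢ : ∀ i → partner i ≢ i
  partner≢ i = proj₂ (fresh (<⇒≤ (<⇒≤ 3<n)) (i ∷ [])) zero

  lift-partner : ∀ i → Plain.Lift (E i (partner i) 1#)
  lift-partner i = lift-E (partner≢ i ∘ ≡.sym) 1#

  u : V n
  u i = top (proj₁ (lift-partner i)) (partner i)

  top-E-on : ∀ {i j t g} → i ≢ j → Γ g → π g ≋ E i j t → top g j ≈ t * u i
  top-E-on {i} {j} {t} i≢j g∈Γ πg≋E with j ≟ partner i | lift-partner i
  ... | no j≢partner | _ , g₁∈Γ , πg₁≋E , _ =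
    top-E-scale i≢j (partner≢ i ∘ ≡.sym) (j≢partner ∘ ≡.sym) g₁∈Γ πg₁≋E g∈Γ πg≋E
  ... | yes ≡.refl | _ , g₁∈Γ , πg₁≋E , _ =
    -- j is the partner of i itself: pass through a third index k
    let k , k∉ = fresh (<⇒≤ 3<n) (i ∷ j ∷ [])
        h , h∈Γ , πh≋E , _ = lift-E (k∉ zero ∘ ≡.sym) 1#
    in trans (top-E-scale i≢j (k∉ zero ∘ ≡.sym) (k∉ (suc zero)) h∈Γ πh≋E g∈Γ πg≋E)
             (*-congˡ (trans (top-E-scale (k∉ zero ∘ ≡.sym) i≢j (k∉ (suc zero) ∘ ≡.sym) g₁∈Γ πg₁≋E h∈Γ πh≋E)
                             (*-identityˡ _)))

  top-E : ∀ {i j t g} → i ≢ j → Γ g → π g ≋ E i j t → top g ≐ ((t * u i) *ᵛ I j)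
  top-E {i} {j} {t} i≢j g∈Γ πg≋E l with l ≟ j
  ... | yes ≡.refl = trans (top-E-on i≢j g∈Γ πg≋E) (sym (trans (*-congˡ (reflexive (I-diag l))) (*-identityʳ _)))
  ... | no l≢j = trans (top-E-off i≢j g∈Γ πg≋E l≢j) (sym (*-zeroʳ-≈ (reflexive (I-off (l≢j ∘ ≡.sym)))))

  DefectFree : M → Set ℓ
  DefectFree g = ∀ k → defect u g k ≈ 0#

  defectFree-I : DefectFree I
  defectFree-I k =
    trans (+-congʳ (+-identityˡ (u k))) (trans (+-congˡ (-‿cong (⊙-identityʳ u k))) (-‿inverseʳ (u k)))

  defectFree-· : ∀ {g h} → Γ g → DefectFree g → DefectFree h → DefectFree (g · h)
  defectFree-· {g} {h} g∈Γ g-free h-free k =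
    trans (defect-· u h (Γ⊆T g g∈Γ) k) (trans (+-cong (h-free k) (⊙-zeroˡ (π h) g-free k)) (+-identityˡ 0#))

  defectFree-inverse : ∀ {g h} → Γ g → (g · h) ≋ I → DefectFree g → DefectFree h
  defectFree-inverse {g} {h} g∈Γ gh≋I g-free k = begin
    defect u h k                            ≈⟨ +-identityʳ-≈ (⊙-zeroˡ (π h) g-free k) ⟨
    defect u h k + (defect u g ⊙ π h) k     ≈⟨ defect-· u h (Γ⊆T g g∈Γ) k ⟨
    defect u (g · h) k                      ≈⟨ defect-cong u {g · h} gh≋I k ⟩
    defect u I k                            ≈⟨ defectFree-I k ⟩
    0#                                      ∎
    where open ≈-Reasoning

  module Tame = Lifting DefectFree defectFree-I
                 (λ {g} {h} → defectFree-· {g} {h}) (λ {g} {h} → defectFree-inverse {g} {h})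

  tame-E : ∀ {a b} → a ≢ b → ∀ t → Tame.Lift (E a b t)
  tame-E {a} {b} a≢b t = let g , g∈Γ , πg≋E , _ = lift-E a≢b t in g , g∈Γ , πg≋E , λ l → begin
    top g l + u l - (u ⊙ π g) l
      ≈⟨ +-cong (+-congʳ (top-E a≢b g∈Γ πg≋E l)) (-‿cong (⊙-congˡ u πg≋E l)) ⟩
    (t * u a) * I b l + u l - (u ⊙ E a b t) l
      ≈⟨ +-congˡ (-‿cong (trans (⊙-E u a b t l) (+-comm _ _))) ⟩
    (t * u a) * I b l + u l - ((t * u a) * I b l + u l)
      ≈⟨ -‿inverseʳ _ ⟩
    0# ∎
    where open ≈-Reasoning

  tame-closed : ElementaryClosed Tame.Lift
  tame-closed = record
    { resp = Tame.lift-resp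
    ; contains-I = Tame.lift-I
    ; closed-· = Tame.lift-·
    ; closed-÷ = Tame.lift-÷
    ; contains-E = tame-E
    }

  defect-vanishes-at : ∀ {i j g gᴱ gτ} → Γ g → Γ gᴱ → Γ gτ → π gᴱ ≋ E i j 1# →
    DefectFree gᴱ → DefectFree gτ → (g · gᴱ) ≋ (gτ · g) → defect u g i ≈ 0#
  defect-vanishes-at {i} {j} {g} {gᴱ} {gτ} g∈Γ gᴱ∈Γ gτ∈Γ πgᴱ≋E gᴱ-free gτ-free ggᴱ≋gτg =
    ∙-cancelˡ (δ j) _ _ (begin
      δ j + δ i                              ≈⟨ +-congˡ (*-identityˡ _) ⟨
      δ j + 1# * δ i                         ≈⟨ ⊙-E-on δ i j 1# ⟨
      (δ ⊙ E i j 1#) j                       ≈⟨ +-identityˡ-≈ (gᴱ-free j) ⟨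
      defect u gᴱ j + (δ ⊙ E i j 1#) j       ≈⟨ +-congˡ (⊙-congˡ δ πgᴱ≋E j) ⟨
      defect u gᴱ j + (δ ⊙ π gᴱ) j           ≈⟨ defect-· u gᴱ (Γ⊆T g g∈Γ) j ⟨
      defect u (g · gᴱ) j                    ≈⟨ defect-cong u ggᴱ≋gτg j ⟩
      defect u (gτ · g) j                    ≈⟨ defect-· u g (Γ⊆T gτ gτ∈Γ) j ⟩
      δ j + (defect u gτ ⊙ π g) j            ≈⟨ +-identityʳ-≈ (⊙-zeroˡ (π g) gτ-free j) ⟩
      δ j                                    ≈⟨ +-identityʳ _ ⟨
      δ j + 0#                               ∎)
    where
    open ≈-Reasoning
    δ : V n
    δ = defect u g

  -- π g conjugates E i j 1 into a transvection, whose tame lift is the gτ of defect-vanishes-at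
  defect-vanishes : ∀ {g} → Γ g → DefectFree g
  defect-vanishes {g} g∈Γ i = from-lifts (tame-E (partner≢ i ∘ ≡.sym) 1#) tame-τ
    where
    h : M
    h = proj₁ (Γ-inv g∈Γ)
    πhπg≋I : (π h · π g) ≋ I
    πhπg≋I = π-·-inverse g (proj₁ (proj₂ (Γ-inv g∈Γ))) (proj₂ (proj₂ (proj₂ (Γ-inv g∈Γ))))
    j : Fin n
    j = partner i
    v w : V n
    v r = π g r i
    w = π h j

    conjugate : (π g · E i j 1#) ≋ (T v w · π g)
    conjugate = ≋-trans (T-conj (1# *ᵛ I i) (I j) πhπg≋I)
      (·-cong (T-cong (λ r → trans (Σ-cong n (λ m → *-congˡ (*-identityˡ _))) (dot-selectʳ (π g r) i))
                      (λ k → Σ-selectˡ n j (λ m → π h m k))) ≋-refl)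

    tame-τ : Tame.Lift (T v w)
    tame-τ = ElementaryClosed.T∈ tame-closed (<⇒≤ 3<n) v w (λ r → π g r j)
      (trans (πhπg≋I j i) (reflexive (I-off (partner≢ i))))
      (trans (πhπg≋I j j) (reflexive (I-diag j)))

    from-lifts : Tame.Lift (E i j 1#) → Tame.Lift (T v w) → defect u g i ≈ 0#
    from-lifts (gᴱ , gᴱ∈Γ , πgᴱ≋E , gᴱ-free) (gτ , gτ∈Γ , πgτ≋T , gτ-free) =
      defect-vanishes-at g∈Γ gᴱ∈Γ gτ∈Γ πgᴱ≋E gᴱ-free gτ-free
        (π-injective _ _ (Γ-· g∈Γ gᴱ∈Γ) (Γ-· gτ∈Γ g∈Γ) (begin
        π (g · gᴱ)       ≈⟨ π-· gᴱ (Γ⊆T g g∈Γ) ⟩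
        π g · π gᴱ       ≈⟨ ·-cong ≋-refl πgᴱ≋E ⟩
        π g · E i j 1#   ≈⟨ conjugate ⟩
        T v w · π g      ≈⟨ ·-cong πgτ≋T ≋-refl ⟨
        π gτ · π g       ≈⟨ π-· g (Γ⊆T gτ gτ∈Γ) ⟨
        π (gτ · g)       ∎))
      where open ≋-Reasoning

  splitting : Σ M (λ U → Σ M (λ V → InT U × ((U · V) ≋ I) × ((V · U) ≋ I) × (∀ g → Γ g → InD ((V · g) · U))))
  splitting = shear u , shear (-ᵛ u) , shear-InT u ,
    shear-inverse u (-ᵛ u) (λ k → -‿inverseʳ (u k)) ,
    shear-inverse (-ᵛ u) u (λ k → -‿inverseˡ (u k)) ,
    λ g g∈Γ → shear-conjugate u (Γ⊆T g g∈Γ) (defect-vanishes g∈Γ)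

lemma7p2 : {c ℓ p : Level} (F : Field c ℓ) (n : ℕ) → 4 ≤ n →
    let open FieldMatrices F in
    (Γ : Mat (suc n) (suc n) → Set p) →
    IsSubgroup Γ →
    (∀ g → Γ g → InT g) →
    (∀ g h → Γ g → Γ h → π g ≋ π h → g ≋ h) →
    (∀ A → IsSL A → Σ (Mat (suc n) (suc n)) (λ g → Γ g × (π g ≋ A))) →
    Σ (Mat (suc n) (suc n)) (λ U → Σ (Mat (suc n) (suc n)) (λ V →
      InT U × ((U · V) ≋ I) × ((V · U) ≋ I) ×
      (∀ g → Γ g → InD ((V · g) · U))))
lemma7p2 F n 4≤n Γ Γ-subgroup Γ⊆T π-injective SL⊆πΓ =
  Splitting.splitting F n 4≤n Γ Γ-subgroup Γ⊆T π-injective SL⊆πΓ
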